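{- Let $G=(V,E)$ be a weighted multi-graph with integer edge weights in $\{1,\dots,W\}$ and capacities $\{b_v\}_{v\in V}$, let $H$ be a $(\beta,\beta^-)$-$w$-$b$-EDCS of $G$ for some integers $\beta\geq 3$, $\beta^-\leq\beta-2$, and let $M_G$ be a maximum weight $b$-matching of $G$. Fix $v\in V$ and let $S=\delta_G(v)\cap(H\cup M_G)$. Then the multi-set $S$ can be partitioned into $b_v$ multi-sets $E_1,\dots,E_{b_v}$ such that: (i) each $E_i$ contains at most one edge of $M_G$; (ii) for each $i$ and each vertex $u\neq v$, $E_i$ contains at most one edge between $u$ and $v$; (iii) for each $i$, $w(E_i)\in\left[\frac{\mathbf{w}\!\deg_H(v)}{b_v} - 2W, \frac{\mathbf{w}\!\deg_H(v)}{b_v} + 3W \right]$, where $w(E_i)$ is the total weight of the edges in $E_i$.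
   Context: A weighted multi-graph $G=(V,E)$ has a multi-set of weighted edges $(u,v,k)$ with $u\neq v$ and weight $k\in\{1,\dots,W\}$. Each vertex $v$ has a positive integer capacity $b_v$, and the number of edges between any two vertices $u,v$ is at most $\min(b_u,b_v)$. A $b$-matching is a multi-set $M$ of edges with at most $b_v$ edges of $M$ incident to each $v$. For a subgraph $F$, $\delta_F(v)$ is the multi-set of edges of $F$ incident to $v$ and $\mathbf{w}\!\deg_F(v)=\sum_{e\in\delta_F(v)}w(e)$. A subgraph $H$ is a $(\beta,\beta^-)$-$w$-$b$-EDCS of $G$ if (i) for every edge $(u,v,w_{uv})\in H$, $\frac{\mathbf{w}\!\deg_H(u)}{b_u}+\frac{\mathbf{w}\!\deg_H(v)}{b_v}\leq\beta\cdot w_{uv}$, and (ii) for every edge $(u,v,w_{uv})\in G\setminus H$, $\frac{\mathbf{w}\!\deg_H(u)}{b_u}+\frac{\mathbf{w}\!\deg_H(v)}{b_v}\geq\beta^-\cdot w_{uv}$. -}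

module Defs where

open import Data.Nat using (ℕ; zero; suc; _+_; _*_; _≤_; _⊓_)
open import Data.Integer as ℤ using (ℤ; +_)
open import Data.Fin using (Fin; _≟_)
open import Data.Bool using (Bool; true; false; _∧_; _∨_; if_then_else_)
open import Data.List using (List; map; allFin)
open import Data.Nat.ListAction using (sum)
open import Data.Product using (_×_)
open import Relation.Nullary.Decidable using (⌊_⌋)
open import Relation.Nullary using (¬_)
open import Relation.Binary.PropositionalEquality using (_≡_)

-- A weighted multi-graph on vertex set Fin n with m edges, indexed by Fin m.
-- Parallel edges are distinct indices (this realises the multi-set of edges).
record WGraph (n m : ℕ) : Set where
  field
    src tgt : Fin m → Fin n
    wt      : Fin m → ℕ

-- Sub-multi-sets of the edge multi-set: subsets of edge indices.
EdgeSet : ℕ → Set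
EdgeSet m = Fin m → Bool

module _ {n m : ℕ} (G : WGraph n m) where
  open WGraph G

  sumOver : EdgeSet m → (Fin m → ℕ) → ℕ
  sumOver S f = sum (map (λ e → if S e then f e else 0) (allFin m))

  card : EdgeSet m → ℕ
  card S = sumOver S (λ _ → 1)

  weight : EdgeSet m → ℕ
  weight S = sumOver S wt

  incident : Fin m → Fin n → Bool
  incident e v = ⌊ src e ≟ v ⌋ ∨ ⌊ tgt e ≟ v ⌋

  between : Fin m → Fin n → Fin n → Bool
  between e u v = (⌊ src e ≟ u ⌋ ∧ ⌊ tgt e ≟ v ⌋) ∨ (⌊ src e ≟ v ⌋ ∧ ⌊ tgt e ≟ u ⌋)

  δ : EdgeSet m → Fin n → EdgeSet m
  δ F v e = F e ∧ incident e v

  wdeg : EdgeSet m → Fin n → ℕ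
  wdeg F v = weight (δ F v)

  allEdges : EdgeSet m
  allEdges _ = true

  IsValid : ℕ → (Fin n → ℕ) → Set
  IsValid W b =
    (∀ e → ¬ (src e ≡ tgt e)) ×
    (∀ e → 1 ≤ wt e) × (∀ e → wt e ≤ W) ×
    (∀ v → 1 ≤ b v) ×
    (∀ u v → ¬ (u ≡ v) → card (λ e → between e u v) ≤ b u ⊓ b v)

  IsBMatching : (Fin n → ℕ) → EdgeSet m → Set
  IsBMatching b M = ∀ v → card (δ M v) ≤ b v

  IsMaxWeightBMatching : (Fin n → ℕ) → EdgeSet m → Set
  IsMaxWeightBMatching b M =
    IsBMatching b M × (∀ M' → IsBMatching b M' → weight M' ≤ weight M)

  -- (β , β⁻)-w-b-EDCS. The rational conditions
  --   wdeg(u)/b_u + wdeg(v)/b_v ≤ β·w   and   ≥ β⁻·w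
  -- are stated after multiplying through by b_u·b_v > 0.
  IsEDCS : (Fin n → ℕ) → ℤ → ℤ → EdgeSet m → Set
  IsEDCS b β β⁻ H =
    (∀ e → H e ≡ true →
       let u = src e ; v = tgt e in
       + (wdeg H u * b v + wdeg H v * b u) ℤ.≤ β ℤ.* + (wt e * b u * b v)) ×
    (∀ e → H e ≡ false →
       let u = src e ; v = tgt e in
       β⁻ ℤ.* + (wt e * b u * b v) ℤ.≤ + (wdeg H u * b v + wdeg H v * b u))

{-# OPTIONS --safe #-}
module Submission where

-- The classes are filled greedily. The matching edges at v come first, one per class, placed by
-- their rank among the matching edges at v. The other H-edges at v are then placed neighbour by
-- neighbour, each group in order of decreasing weight, every edge going to a class of least load
-- (H-weight) that holds no edge to that neighbour yet; such a class exists because there are at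
-- most b_v parallel edges. A round thus hands out items as in sorted round robin, except that
-- classes holding a matching edge to the current neighbour are blocked. A class that can still be
-- blocked later stays within W of the maximum load, and since each class is blocked at most once,
-- all loads stay within 2W of each other. Every class has at most one edge outside H, of weight at
-- most W, so averaging the loads, whose sum is wdeg_H(v), gives the bounds.

open import Defs
open import Data.Nat using (ℕ; zero; suc; _+_; _*_; _≤_; _<_; _≤?_; _<?_; z≤n; z<s; _⊓_)
open import Data.Nat.Properties hiding (_≟_)
open import Data.Nat.Properties using () renaming (_≟_ to _≟ℕ_)
open import Data.Integer as ℤ using (ℤ; +_)
open import Data.Fin using (Fin; zero; suc; _≟_; toℕ; fromℕ<)
import Data.Fin.Properties as Fin
open import Data.Bool using (Bool; true; false; T; _∧_; _∨_; not; if_then_else_)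
open import Data.Bool.Properties using (T-∧; ∧-zeroʳ; ∧-identityʳ)
open import Data.Unit using (tt)
open import Data.Empty using (⊥; ⊥-elim)
open import Data.Product as Product using (Σ; ∃; _×_; _,_; proj₁; proj₂)
open import Data.Sum as Sum using (_⊎_; inj₁; inj₂)
open import Data.List using (_∷_; []; foldl; allFin; tabulate)
import Data.List.Properties as List
open import Data.Nat.ListAction using () renaming (sum to listSum)
open import Data.List.Membership.Propositional using (_∈_)
open import Data.List.Relation.Unary.Any using (here; there)
open import Data.List.Membership.Propositional.Properties using (∈-allFin)
open import Function using (_∘_; Equivalence)
open Equivalence using (from)
open import Relation.Nullary using (¬_; yes; no)
open import Relation.Nullary.Decidable using (⌊_⌋; toWitness; fromWitness; T?; _×-dec_; ¬?; decidable-stable)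
open import Level using (0ℓ)
open import Relation.Unary using (Pred; Decidable)
open import Relation.Binary using (tri<; tri≈; tri>)
open import Relation.Binary.PropositionalEquality
open import Data.Nat.Solver using (module +-*-Solver)
open +-*-Solver using (solve; _:+_; _:*_; _:=_; con)
open import Algebra.Properties.CommutativeMonoid.Sum +-0-commutativeMonoid
  using (sum; sum-syntax; sum-cong-≗; ∑-distrib-+; ∑-comm)

T-extensional : ∀ {x y} → (T x → T y) → (T y → T x) → x ≡ y
T-extensional {false} {false} _   _   = refl
T-extensional {false} {true}  _   y⇒x = ⊥-elim (y⇒x tt)
T-extensional {true}  {false} x⇒y _   = ⊥-elim (x⇒y tt)
T-extensional {true}  {true}  _   _   = refl

∧-elim : ∀ x {y} → T (x ∧ y) → T x × T y
∧-elim true t = tt , t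

not⇒¬ : ∀ x → T (not x) → ¬ T x
not⇒¬ false _ ()

when : Bool → ℕ → ℕ
when b x = if b then x else 0

when-≤ : ∀ b x → when b x ≤ x
when-≤ false x = z≤n
when-≤ true  x = ≤-refl

when-pos : ∀ {b x} → 0 < when b x → T b
when-pos {true} _ = tt

when-true : ∀ {b} x → T b → when b x ≡ x
when-true {true} x _ = refl

when-false : ∀ {b} x → ¬ T b → when b x ≡ 0
when-false {false} x _  = refl
when-false {true}  x ¬t = ⊥-elim (¬t tt)

when-mono : ∀ {a b} x → (T a → T b) → when a x ≤ when b x
when-mono {false} x _ = z≤n
when-mono {true}  x h = ≤-reflexive (sym (when-true x (h tt)))

when-split : ∀ a b x → when a x ≡ when (a ∧ b) x + when (a ∧ not b) x
when-split false b     x = refl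
when-split true  true  x = sym (+-identityʳ x)
when-split true  false x = refl

when-∧-∧ : ∀ a b c x → when ((a ∧ b) ∧ c) x ≡ when b (when (a ∧ c) x)
when-∧-∧ false false c x = refl
when-∧-∧ false true  c x = refl
when-∧-∧ true  false c x = refl
when-∧-∧ true  true  c x = refl

∑-const : ∀ n c → ∑[ i < n ] c ≡ n * c
∑-const zero    c = refl
∑-const (suc n) c = cong (_+_ c) (∑-const n c)

∑-mono-≤ : ∀ {n} {f g : Fin n → ℕ} → (∀ i → f i ≤ g i) → sum f ≤ sum g
∑-mono-≤ {zero}  f≤g = z≤n
∑-mono-≤ {suc n} f≤g = +-mono-≤ (f≤g zero) (∑-mono-≤ (f≤g ∘ suc))

∑≤* : ∀ {n} {t : Fin n → ℕ} {x} → (∀ j → t j ≤ x) → sum t ≤ n * x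
∑≤* {n} {x = x} t≤x = ≤-trans (∑-mono-≤ t≤x) (≤-reflexive (∑-const n x))

*≤∑ : ∀ {n} {t : Fin n → ℕ} {x} → (∀ j → x ≤ t j) → n * x ≤ sum t
*≤∑ {n} {x = x} x≤t = ≤-trans (≤-reflexive (sym (∑-const n x))) (∑-mono-≤ x≤t)

∑-mono-< : ∀ {n} {f g : Fin n → ℕ} → (∀ i → f i ≤ g i) → ∀ a → f a < g a → sum f < sum g
∑-mono-< f≤g zero    fa<ga = +-mono-<-≤ fa<ga (∑-mono-≤ (f≤g ∘ suc))
∑-mono-< f≤g (suc a) fa<ga = +-mono-≤-< (f≤g zero) (∑-mono-< (f≤g ∘ suc) a fa<ga)

term≤∑ : ∀ {n} (f : Fin n → ℕ) a → f a ≤ sum f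
term≤∑ f zero    = m≤m+n (f zero) _
term≤∑ f (suc a) = ≤-trans (term≤∑ (f ∘ suc) a) (m≤n+m _ (f zero))

∑-zero : ∀ {n} {f : Fin n → ℕ} → (∀ i → f i ≡ 0) → sum f ≡ 0
∑-zero {zero}  f≡0 = refl
∑-zero {suc n} f≡0 = cong₂ _+_ (f≡0 zero) (∑-zero (f≡0 ∘ suc))

∑-indicator : ∀ {n} (a : Fin n) x → ∑[ i < n ] when ⌊ a ≟ i ⌋ x ≡ x
∑-indicator {suc n} zero x = trans (cong (_+_ x) (∑-zero {n} (λ _ → refl))) (+-identityʳ x)
∑-indicator {suc n} (suc a) x = trans (sum-cong-≗ suc≟suc) (∑-indicator a x)
  where
  suc≟suc : ∀ i → when ⌊ suc a ≟ suc i ⌋ x ≡ when ⌊ a ≟ i ⌋ x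
  suc≟suc i with a ≟ i
  ... | yes _ = refl
  ... | no  _ = refl

∑≤-unique-support : ∀ {n} {f : Fin n → ℕ} K → (∀ i j → 0 < f i → 0 < f j → i ≡ j) →
                    (∀ i → f i ≤ K) → sum f ≤ K
∑≤-unique-support {zero}      K unique f≤K = z≤n
∑≤-unique-support {suc n} {f} K unique f≤K with f zero in f0
... | zero  = ∑≤-unique-support K (λ i j p q → Fin.suc-injective (unique (suc i) (suc j) p q)) (f≤K ∘ suc)
... | suc x = begin
  suc x + sum (f ∘ suc) ≡⟨ cong (_+_ (suc x)) (∑-zero rest≡0) ⟩
  suc x + 0             ≡⟨ +-identityʳ _ ⟩
  suc x                 ≡⟨ f0 ⟨
  f zero                ≤⟨ f≤K zero ⟩
  K                     ∎
  where
  open ≤-Reasoning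
  rest≡0 : ∀ i → f (suc i) ≡ 0
  rest≡0 i with f (suc i) in fi
  ... | zero  = refl
  ... | suc _ with () ← unique zero (suc i) (subst (0 <_) (sym f0) z<s) (subst (0 <_) (sym fi) z<s)

sum-tabulate : ∀ {n} (f : Fin n → ℕ) → listSum (tabulate f) ≡ sum f
sum-tabulate {zero}  f = refl
sum-tabulate {suc n} f = cong (_+_ (f zero)) (sum-tabulate (f ∘ suc))

sumOver≡∑ : ∀ {n m} (G : WGraph n m) S f → sumOver G S f ≡ ∑[ e < m ] when (S e) (f e)
sumOver≡∑ {m = m} G S f =
  trans (cong listSum (List.map-tabulate {n = m} (λ e → e) (λ e → when (S e) (f e)))) (sum-tabulate {m} _)

count : ∀ {m} → (Fin m → Bool) → ℕ
count {m} X = ∑[ e < m ] when (X e) 1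

count≤1 : ∀ {m} {X : Fin m → Bool} → (∀ e e' → T (X e) → T (X e') → e ≡ e') → count X ≤ 1
count≤1 unique =
  ∑≤-unique-support 1 (λ e e' p q → unique e e' (when-pos p) (when-pos q)) (λ e → when-≤ _ 1)

count-< : ∀ {m} {X Y : Fin m → Bool} → (∀ e → T (X e) → T (Y e)) →
          ∀ a → ¬ T (X a) → T (Y a) → count X < count Y
count-< {X = X} {Y} X⊆Y a ¬Xa Ya = ∑-mono-< (λ e → when-mono 1 (X⊆Y e)) a strict
  where
  strict : when (X a) 1 < when (Y a) 1
  strict rewrite when-false 1 ¬Xa | when-true 1 Ya = z<s

count-covering : ∀ {m d} {X : Fin m → Bool} (f : Fin m → Fin d) →
                 (∀ i → ∃ λ e → T (X e) × f e ≡ i) → d ≤ count X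
count-covering {m} {d} {X} f covered = begin
  d                                                ≡⟨ *-identityʳ d ⟨
  d * 1                                            ≡⟨ ∑-const d 1 ⟨
  ∑[ i < d ] 1                                     ≤⟨ ∑-mono-≤ hit ⟩
  ∑[ i < d ] ∑[ e < m ] when ⌊ f e ≟ i ⌋ (Xₑ e)   ≡⟨ ∑-comm (λ i e → when ⌊ f e ≟ i ⌋ (Xₑ e)) ⟩
  ∑[ e < m ] ∑[ i < d ] when ⌊ f e ≟ i ⌋ (Xₑ e)   ≡⟨ sum-cong-≗ (λ e → ∑-indicator (f e) (Xₑ e)) ⟩
  count X                                          ∎
  where
  open ≤-Reasoning
  Xₑ : Fin m → ℕ
  Xₑ e = when (X e) 1
  hit : ∀ i → 1 ≤ ∑[ e < m ] when ⌊ f e ≟ i ⌋ (Xₑ e)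
  hit i with covered i
  ... | e , Xe , refl = ≤-trans one (term≤∑ (λ e' → when ⌊ f e' ≟ f e ⌋ (Xₑ e')) e)
    where
    one : 1 ≤ when ⌊ f e ≟ f e ⌋ (Xₑ e)
    one rewrite when-true 1 Xe | when-true {⌊ f e ≟ f e ⌋} 1 (fromWitness refl) = ≤-refl

argmin : ∀ {d p} {P : Pred (Fin d) p} → Decidable P → (t : Fin d → ℕ) →
         (∀ i → ¬ P i) ⊎ ∃ λ a → P a × (∀ j → P j → t a ≤ t j)
argmin {zero}  P? t = inj₁ λ ()
argmin {suc d} P? t with argmin (P? ∘ suc) (t ∘ suc) | P? zero
... | inj₁ none              | no ¬P0 = inj₁ λ { zero → ¬P0 ; (suc i) → none i }
... | inj₁ none              | yes P0 =
  inj₂ (zero , P0 , λ { zero _ → ≤-refl ; (suc j) Pj → ⊥-elim (none j Pj) })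
... | inj₂ (a , Pa , minimal) | no ¬P0 =
  inj₂ (suc a , Pa , λ { zero P0 → ⊥-elim (¬P0 P0) ; (suc j) Pj → minimal j Pj })
... | inj₂ (a , Pa , minimal) | yes P0 with t zero ≤? t (suc a)
...   | yes t0≤ = inj₂ (zero , P0 , λ { zero _ → ≤-refl ; (suc j) Pj → ≤-trans t0≤ (minimal j Pj) })
...   | no  t0≰ = inj₂ (suc a , Pa , λ { zero _ → <⇒≤ (≰⇒> t0≰) ; (suc j) Pj → minimal j Pj })

module _ {m : ℕ} (X : Fin m → Bool) where

  rank : Fin m → ℕ
  rank e = count (λ x → X x ∧ ⌊ toℕ x <? toℕ e ⌋)

  private
    counted⁻ : ∀ {x e : Fin m} → T (X x ∧ ⌊ toℕ x <? toℕ e ⌋) → T (X x) × toℕ x < toℕ e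
    counted⁻ {x} {e} h with X x | toℕ x <? toℕ e
    ... | true | yes x<e = tt , x<e

    counted⁺ : ∀ {x e : Fin m} → T (X x) → toℕ x < toℕ e → T (X x ∧ ⌊ toℕ x <? toℕ e ⌋)
    counted⁺ {x} {e} Xx x<e with X x | toℕ x <? toℕ e
    ... | true | yes _   = tt
    ... | true | no x≮e  = x≮e x<e

    uncounted-self : ∀ {e : Fin m} → ¬ T (X e ∧ ⌊ toℕ e <? toℕ e ⌋)
    uncounted-self h = <-irrefl refl (proj₂ (counted⁻ h))

  rank<count : ∀ {e : Fin m} → T (X e) → rank e < count X
  rank<count {e} Xe = count-< (λ x → proj₁ ∘ counted⁻) e uncounted-self Xe

  rank-strictMono : ∀ {e e' : Fin m} → T (X e) → toℕ e < toℕ e' → rank e < rank e'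
  rank-strictMono {e} {e'} Xe e<e' = count-< below-e⇒below-e' e uncounted-self (counted⁺ Xe e<e')
    where
    below-e⇒below-e' : ∀ x → T (X x ∧ ⌊ toℕ x <? toℕ e ⌋) → T (X x ∧ ⌊ toℕ x <? toℕ e' ⌋)
    below-e⇒below-e' x h = let Xx , x<e = counted⁻ h in counted⁺ Xx (<-trans x<e e<e')

  rank-injective : ∀ {e e' : Fin m} → T (X e) → T (X e') → rank e ≡ rank e' → e ≡ e'
  rank-injective {e} {e'} Xe Xe' r≡r' with Fin.<-cmp e e'
  ... | tri< e<e' _ _ = ⊥-elim (<-irrefl r≡r' (rank-strictMono Xe e<e'))
  ... | tri≈ _ e≡e' _ = e≡e'
  ... | tri> _ _ e'<e = ⊥-elim (<-irrefl (sym r≡r') (rank-strictMono Xe' e'<e))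

module _ {S A : Set} (f : S → A → S) where

  foldl-preserves : (I : S → Set) → (∀ {s} x → I s → I (f s x)) → ∀ {s} xs → I s → I (foldl f s xs)
  foldl-preserves I pres []       Is = Is
  foldl-preserves I pres (x ∷ xs) Is = foldl-preserves I pres xs (pres x Is)

  foldl-establishes : (I Q : S → Set) → (∀ {s} x → I s → I (f s x)) → (∀ {s} x → Q s → Q (f s x)) →
                      ∀ {y} → (∀ {s} → I s → Q (f s y)) → ∀ {s xs} → y ∈ xs → I s → Q (foldl f s xs)
  foldl-establishes I Q presI presQ estQ {xs = x ∷ xs} (here refl) Is = foldl-preserves Q presQ xs (estQ Is)
  foldl-establishes I Q presI presQ estQ {xs = x ∷ xs} (there y∈xs) Is =
    foldl-establishes I Q presI presQ estQ y∈xs (presI x Is)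

-- A round hands out items of non-increasing weight, at most W, to d classes, at most one item per
-- class, each item going to a least loaded class that is not yet occupied. In Round c ω Occ t, the
-- loads are c before the round and t now, ω is the weight of the last item, and Occ is the set of
-- occupied classes, which starts out as the classes that are blocked in this round.
module Balancing {d : ℕ} (W : ℕ) where

  NearMax : ℕ → (Fin d → ℕ) → Fin d → Set
  NearMax K t i = ∀ j → t j ≤ t i + K

  record Round (c : Fin d → ℕ) (ω : ℕ) (Occ : Pred (Fin d) 0ℓ) (t : Fin d → ℕ) : Set where
    field
      grows          : ∀ i → c i ≤ t i
      gains≤W        : ∀ i → t i ≤ c i + W
      gains≥ω        : ∀ i → c i < t i → ω + c i ≤ t i
      greedy         : ∀ i → ¬ Occ i → ∀ j → c j < t j → c j ≤ c i
      blocked        : ∀ i → Occ i → t i ≡ c i → NearMax W c i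
      lowerGainsMore : ∀ i j → c i < t i → c j < t j → c i < c j → t j + c i ≤ t i + c j
      gainedOccupied : ∀ i → c i < t i → Occ i

    unoccupied-unchanged : ∀ {i} → ¬ Occ i → t i ≡ c i
    unoccupied-unchanged {i} ¬Occ with m≤n⇒m<n∨m≡n (grows i)
    ... | inj₁ ci<ti = ⊥-elim (¬Occ (gainedOccupied i ci<ti))
    ... | inj₂ ci≡ti = sym ci≡ti

  round-start : ∀ {c ω} {Occ : Pred (Fin d) 0ℓ} → (∀ i → Occ i → NearMax W c i) → Round c ω Occ c
  round-start {c} blocked = record
    { grows          = λ i → ≤-refl
    ; gains≤W        = λ i → m≤m+n (c i) W
    ; gains≥ω        = λ i ci<ci → ⊥-elim (<-irrefl refl ci<ci)
    ; greedy         = λ i _ j cj<cj → ⊥-elim (<-irrefl refl cj<cj)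
    ; blocked        = λ i Occi _ → blocked i Occi
    ; lowerGainsMore = λ i j ci<ci _ _ → ⊥-elim (<-irrefl refl ci<ci)
    ; gainedOccupied = λ i ci<ci → ⊥-elim (<-irrefl refl ci<ci)
    }

  round-weaken : ∀ {c ω ω' Occ t} → ω' ≤ ω → Round c ω Occ t → Round c ω' Occ t
  round-weaken ω'≤ω R = record
    { grows          = grows
    ; gains≤W        = gains≤W
    ; gains≥ω        = λ i ci<ti → ≤-trans (+-monoˡ-≤ _ ω'≤ω) (gains≥ω i ci<ti)
    ; greedy         = greedy
    ; blocked        = blocked
    ; lowerGainsMore = lowerGainsMore
    ; gainedOccupied = gainedOccupied
    }
    where open Round R

  module _ {c t : Fin d → ℕ} {ω : ℕ} {Occ : Pred (Fin d) 0ℓ} (R : Round c ω Occ t)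
           (a : Fin d) (¬Occa : ¬ Occ a) (minimal : ∀ j → ¬ Occ j → t a ≤ t j)
           {w : ℕ} (1≤w : 1 ≤ w) (w≤W : w ≤ W) (w≤ω : w ≤ ω)
           {t' : Fin d → ℕ} (t'≡ : ∀ i → t' i ≡ t i + when ⌊ a ≟ i ⌋ w)
           {Occ' : Pred (Fin d) 0ℓ} (Occ'⁻ : ∀ {i} → Occ' i → a ≡ i ⊎ Occ i) (Occ'a : Occ' a) (Occ⊆Occ' : ∀ {i} → Occ i → Occ' i)
           where
    open Round R
    open ≤-Reasoning

    private
      t'a≡ : t' a ≡ c a + w
      t'a≡ = trans (t'≡ a) (cong₂ _+_ (unoccupied-unchanged ¬Occa) (when-true w (fromWitness refl)))

      t'i≡ : ∀ {i} → a ≢ i → t' i ≡ t i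
      t'i≡ a≢i = trans (t'≡ _) (trans (cong (_+_ _) (when-false w (a≢i ∘ toWitness))) (+-identityʳ _))

      t≤t' : ∀ i → t i ≤ t' i
      t≤t' i = subst (t i ≤_) (sym (t'≡ i)) (m≤m+n (t i) _)

      ca<t'a : c a < t' a
      ca<t'a = begin-strict
        c a      <⟨ m<m+n (c a) 1≤w ⟩
        c a + w  ≡⟨ t'a≡ ⟨
        t' a     ∎

      gains≤W' : ∀ i → t' i ≤ c i + W
      gains≤W' i with a ≟ i
      ... | yes refl = subst (_≤ c a + W) (sym t'a≡) (+-monoʳ-≤ (c a) w≤W)
      ... | no  a≢i  = subst (_≤ c i + W) (sym (t'i≡ a≢i)) (gains≤W i)

      gains≥ω' : ∀ i → c i < t' i → w + c i ≤ t' i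
      gains≥ω' i ci<t'i with a ≟ i
      ... | yes refl = ≤-reflexive (trans (+-comm w (c a)) (sym t'a≡))
      ... | no  a≢i  = begin
        w + c i  ≤⟨ +-monoˡ-≤ (c i) w≤ω ⟩
        ω + c i  ≤⟨ gains≥ω i (subst (c i <_) (t'i≡ a≢i) ci<t'i) ⟩
        t i      ≡⟨ t'i≡ a≢i ⟨
        t' i     ∎

      greedy' : ∀ i → ¬ Occ' i → ∀ j → c j < t' j → c j ≤ c i
      greedy' i ¬Occ'i j cj<t'j with a ≟ j
      ... | yes refl = begin
        c a  ≡⟨ unoccupied-unchanged ¬Occa ⟨
        t a  ≤⟨ minimal i (¬Occ'i ∘ Occ⊆Occ') ⟩
        t i  ≡⟨ unoccupied-unchanged (¬Occ'i ∘ Occ⊆Occ') ⟩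
        c i  ∎
      ... | no  a≢j  = greedy i (¬Occ'i ∘ Occ⊆Occ') j (subst (c j <_) (t'i≡ a≢j) cj<t'j)

      blocked' : ∀ i → Occ' i → t' i ≡ c i → NearMax W c i
      blocked' i Occ'i t'i≡ci with a ≟ i
      ... | yes refl = ⊥-elim (<-irrefl (sym t'i≡ci) ca<t'a)
      ... | no  a≢i with Occ'⁻ Occ'i
      ...   | inj₁ a≡i  = ⊥-elim (a≢i a≡i)
      ...   | inj₂ Occi = blocked i Occi (trans (sym (t'i≡ a≢i)) t'i≡ci)

      lowerGainsMore' : ∀ i j → c i < t' i → c j < t' j → c i < c j → t' j + c i ≤ t' i + c j
      lowerGainsMore' i j ci<t'i cj<t'j ci<cj with a ≟ i | a ≟ j
      ... | yes refl | yes refl = ⊥-elim (<-irrefl refl ci<cj)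
      ... | yes refl | no  a≢j  =
        ⊥-elim (<⇒≱ ci<cj (greedy a ¬Occa j (subst (c j <_) (t'i≡ a≢j) cj<t'j)))
      ... | no  a≢i  | yes refl = begin
        t' a + c i        ≡⟨ cong (_+ c i) t'a≡ ⟩
        c a + w + c i     ≡⟨ +-assoc (c a) w (c i) ⟩
        c a + (w + c i)   ≤⟨ +-monoʳ-≤ (c a) (gains≥ω' i ci<t'i) ⟩
        c a + t' i        ≡⟨ +-comm (c a) (t' i) ⟩
        t' i + c a        ∎
      ... | no  a≢i  | no  a≢j  =
        subst₂ (λ x y → y + c i ≤ x + c j) (sym (t'i≡ a≢i)) (sym (t'i≡ a≢j))
          (lowerGainsMore i j (subst (c i <_) (t'i≡ a≢i) ci<t'i) (subst (c j <_) (t'i≡ a≢j) cj<t'j) ci<cj)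

      gainedOccupied' : ∀ i → c i < t' i → Occ' i
      gainedOccupied' i ci<t'i with a ≟ i
      ... | yes refl = Occ'a
      ... | no  a≢i  = Occ⊆Occ' (gainedOccupied i (subst (c i <_) (t'i≡ a≢i) ci<t'i))

    round-step : Round c w Occ' t'
    round-step = record
      { grows          = λ i → ≤-trans (grows i) (t≤t' i)
      ; gains≤W        = gains≤W'
      ; gains≥ω        = gains≥ω'
      ; greedy         = greedy'
      ; blocked        = blocked'
      ; lowerGainsMore = lowerGainsMore'
      ; gainedOccupied = gainedOccupied'
      }

  private
    cancel-shift : ∀ {a x b y K} → a + x ≤ b + y → y ≤ x + K → a ≤ b + K
    cancel-shift {a} {x} {b} {y} {K} a+x≤b+y y≤x+K = +-cancelʳ-≤ x a (b + K) (begin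
      a + x        ≤⟨ a+x≤b+y ⟩
      b + y        ≤⟨ +-monoʳ-≤ b y≤x+K ⟩
      b + (x + K)  ≡⟨ cong (_+_ b) (+-comm x K) ⟩
      b + (K + x)  ≡⟨ +-assoc b K x ⟨
      b + K + x    ∎)
      where open ≤-Reasoning

  module _ {c t : Fin d → ℕ} {ω : ℕ} {Occ : Pred (Fin d) 0ℓ} (R : Round c ω Occ t) where
    open Round R
    open ≤-Reasoning

    private
      gains-from-lower : ∀ {K i j} → W ≤ K → c j ≤ c i → t j ≤ t i + K
      gains-from-lower {K} {i} {j} W≤K cj≤ci = begin
        t j      ≤⟨ gains≤W j ⟩
        c j + W  ≤⟨ +-mono-≤ cj≤ci W≤K ⟩
        c i + K  ≤⟨ +-monoˡ-≤ K (grows i) ⟩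
        t i + K  ∎

    round-nearMax : ∀ {K} → Decidable Occ → W ≤ K →
                    ∀ {i} → NearMax K c i → (Occ i → t i ≡ c i → W + W ≤ K) → NearMax K t i
    round-nearMax {K} Occ? W≤K {i} near blocked≤K j
      with m≤n⇒m<n∨m≡n (grows j) | m≤n⇒m<n∨m≡n (grows i) | c i <? c j | Occ? i
    ... | inj₂ cj≡tj | _          | _         | _        = begin
      t j      ≡⟨ cj≡tj ⟨
      c j      ≤⟨ near j ⟩
      c i + K  ≤⟨ +-monoˡ-≤ K (grows i) ⟩
      t i + K  ∎
    ... | inj₁ cj<tj | inj₁ ci<ti | yes ci<cj | _        =
      cancel-shift (lowerGainsMore i j ci<ti cj<tj ci<cj) (near j)
    ... | inj₁ cj<tj | inj₁ ci<ti | no  ci≮cj | _        = gains-from-lower W≤K (≮⇒≥ ci≮cj)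
    ... | inj₁ cj<tj | inj₂ ci≡ti | _         | no ¬Occi = gains-from-lower W≤K (greedy i ¬Occi j cj<tj)
    ... | inj₁ cj<tj | inj₂ ci≡ti | _         | yes Occi = begin
      t j            ≤⟨ gains≤W j ⟩
      c j + W        ≤⟨ +-monoˡ-≤ W (blocked i Occi (sym ci≡ti) j) ⟩
      c i + W + W    ≡⟨ +-assoc (c i) W W ⟩
      c i + (W + W)  ≤⟨ +-mono-≤ (grows i) (blocked≤K Occi (sym ci≡ti)) ⟩
      t i + K        ∎

module _ {n m : ℕ} (G : WGraph n m) where
  open WGraph G

  incident⁻ : ∀ {e v} → T (incident G e v) → src e ≡ v ⊎ tgt e ≡ v
  incident⁻ {e} {v} h with src e ≟ v | tgt e ≟ v
  ... | yes s≡v | _       = inj₁ s≡v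
  ... | no  _   | yes t≡v = inj₂ t≡v

  between⁻ : ∀ {e u v} → T (between G e u v) → (src e ≡ u × tgt e ≡ v) ⊎ (src e ≡ v × tgt e ≡ u)
  between⁻ {e} {u} {v} h with src e ≟ u | tgt e ≟ v | src e ≟ v | tgt e ≟ u
  ... | yes s≡u | yes t≡v | _       | _       = inj₁ (s≡u , t≡v)
  ... | yes _   | no  _   | yes s≡v | yes t≡u = inj₂ (s≡v , t≡u)
  ... | no  _   | _       | yes s≡v | yes t≡u = inj₂ (s≡v , t≡u)

  between⁺ : ∀ {e u v} → (src e ≡ u × tgt e ≡ v) ⊎ (src e ≡ v × tgt e ≡ u) → T (between G e u v)
  between⁺ {e} {u} {v} (inj₁ (s≡u , t≡v)) with src e ≟ u | tgt e ≟ v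
  ... | yes _   | yes _   = tt
  ... | no  s≢u | _       = ⊥-elim (s≢u s≡u)
  ... | yes _   | no  t≢v = ⊥-elim (t≢v t≡v)
  between⁺ {e} {u} {v} (inj₂ (s≡v , t≡u)) with ⌊ src e ≟ u ⌋ ∧ ⌊ tgt e ≟ v ⌋ | src e ≟ v | tgt e ≟ u
  ... | true  | _       | _       = tt
  ... | false | yes _   | yes _   = tt
  ... | false | no  s≢v | _       = ⊥-elim (s≢v s≡v)
  ... | false | yes _   | no  t≢u = ⊥-elim (t≢u t≡u)

  neighbour : Fin m → Fin n → Fin n
  neighbour e v = if ⌊ src e ≟ v ⌋ then tgt e else src e

  neighbour-cases : ∀ e v → (src e ≡ v × neighbour e v ≡ tgt e) ⊎ (src e ≢ v × neighbour e v ≡ src e)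
  neighbour-cases e v with src e ≟ v
  ... | yes s≡v = inj₁ (s≡v , refl)
  ... | no  s≢v = inj₂ (s≢v , refl)

  between-neighbour : ∀ {e v} → T (incident G e v) → T (between G e (neighbour e v) v)
  between-neighbour {e} {v} h with neighbour-cases e v | incident⁻ h
  ... | inj₁ (s≡v , nb≡t) | _       = subst (λ u → T (between G e u v)) (sym nb≡t) (between⁺ (inj₂ (s≡v , refl)))
  ... | inj₂ (_ , nb≡s)   | inj₂ t≡v = subst (λ u → T (between G e u v)) (sym nb≡s) (between⁺ (inj₁ (refl , t≡v)))
  ... | inj₂ (s≢v , _)    | inj₁ s≡v = ⊥-elim (s≢v s≡v)

  neighbour-between : ∀ {e u v} → T (between G e u v) → u ≢ v → neighbour e v ≡ u
  neighbour-between {e} {u} {v} h u≢v with neighbour-cases e v | between⁻ h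
  ... | inj₁ (s≡v , _)    | inj₁ (s≡u , _) = ⊥-elim (u≢v (trans (sym s≡u) s≡v))
  ... | inj₁ (_ , nb≡t)   | inj₂ (_ , t≡u) = trans nb≡t t≡u
  ... | inj₂ (_ , nb≡s)   | inj₁ (s≡u , _) = trans nb≡s s≡u
  ... | inj₂ (s≢v , _)    | inj₂ (s≡v , _) = ⊥-elim (s≢v s≡v)

  neighbour≢ : ∀ {e v} → src e ≢ tgt e → T (incident G e v) → neighbour e v ≢ v
  neighbour≢ {e} {v} noLoop h with neighbour-cases e v | incident⁻ h
  ... | inj₁ (s≡v , nb≡t) | _ = λ nb≡v → noLoop (trans s≡v (sym (trans (sym nb≡t) nb≡v)))
  ... | inj₂ (s≢v , nb≡s) | _ = λ nb≡v → s≢v (trans (sym nb≡s) nb≡v)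

module AtVertex {n m : ℕ} (G : WGraph n m) (W : ℕ) (b : Fin n → ℕ) (H M : EdgeSet m) (v : Fin n)
  (noLoop : ∀ e → WGraph.src G e ≢ WGraph.tgt G e)
  (1≤wt : ∀ e → 1 ≤ WGraph.wt G e) (wt≤W : ∀ e → WGraph.wt G e ≤ W) (1≤bᵥ : 1 ≤ b v)
  (multiplicity : ∀ u → u ≢ v → card G (λ e → between G e u v) ≤ b u ⊓ b v)
  (M-capacity : card G (δ G M v) ≤ b v)
  where

  open WGraph G
  open Balancing {b v} W

  d : ℕ
  d = b v

  inc : EdgeSet m
  inc e = incident G e v

  Mᵥ Hᵥ Sᵥ : EdgeSet m
  Mᵥ e = M e ∧ inc e
  Hᵥ e = H e ∧ not (M e) ∧ inc e
  Sᵥ e = (H e ∨ M e) ∧ inc e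

  private
    split-at-v : ∀ h m i → T ((h ∨ m) ∧ i) → T (m ∧ i) ⊎ T (h ∧ not m ∧ i)
    split-at-v true  true  true  _ = inj₁ tt
    split-at-v false true  true  _ = inj₁ tt
    split-at-v true  false true  _ = inj₂ tt

    matched⇒at-v : ∀ h m i → T (m ∧ i) → T ((h ∨ m) ∧ i)
    matched⇒at-v true  true true _ = tt
    matched⇒at-v false true true _ = tt

    unmatched⇒at-v : ∀ h m i → T (h ∧ not m ∧ i) → T ((h ∨ m) ∧ i)
    unmatched⇒at-v true false true _ = tt

    matched⇒¬unmatched : ∀ h m i → T (m ∧ i) → ¬ T (h ∧ not m ∧ i)
    matched⇒¬unmatched true true true _ ()

  Sᵥ⇒Mᵥ⊎Hᵥ : ∀ {e} → T (Sᵥ e) → T (Mᵥ e) ⊎ T (Hᵥ e)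
  Sᵥ⇒Mᵥ⊎Hᵥ {e} = split-at-v (H e) (M e) (inc e)

  Mᵥ⇒Sᵥ : ∀ {e} → T (Mᵥ e) → T (Sᵥ e)
  Mᵥ⇒Sᵥ {e} = matched⇒at-v (H e) (M e) (inc e)

  Hᵥ⇒Sᵥ : ∀ {e} → T (Hᵥ e) → T (Sᵥ e)
  Hᵥ⇒Sᵥ {e} = unmatched⇒at-v (H e) (M e) (inc e)

  Mᵥ⇒¬Hᵥ : ∀ {e} → T (Mᵥ e) → ¬ T (Hᵥ e)
  Mᵥ⇒¬Hᵥ {e} = matched⇒¬unmatched (H e) (M e) (inc e)

  Sᵥ⇒inc : ∀ {e} → T (Sᵥ e) → T (inc e)
  Sᵥ⇒inc {e} = proj₂ ∘ ∧-elim (H e ∨ M e)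

  Hᵥ⇒H : ∀ {e} → T (Hᵥ e) → T (H e)
  Hᵥ⇒H {e} = proj₁ ∘ ∧-elim (H e)

  nb : Fin m → Fin n
  nb e = neighbour G e v

  nb# : Fin m → ℕ
  nb# e = toℕ (nb e)

  -- Only matching edges are placed by rank; the fallback class of the other edges is never used.
  rankClass : Fin m → Fin d
  rankClass e with rank Mᵥ e <? d
  ... | yes r<d = fromℕ< r<d
  ... | no  _   = fromℕ< 1≤bᵥ

  rankClass-injective : ∀ {e e'} → T (Mᵥ e) → T (Mᵥ e') → rankClass e ≡ rankClass e' → e ≡ e'
  rankClass-injective {e} {e'} Mᵥe Mᵥe' r≡r' =
    rank-injective Mᵥ Mᵥe Mᵥe' (trans (sym (toℕ-rankClass Mᵥe)) (trans (cong toℕ r≡r') (toℕ-rankClass Mᵥe')))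
    where
    count-Mᵥ≤d : count Mᵥ ≤ d
    count-Mᵥ≤d = subst (_≤ d) (sumOver≡∑ G (δ G M v) (λ _ → 1)) M-capacity
    toℕ-rankClass : ∀ {x} → T (Mᵥ x) → toℕ (rankClass x) ≡ rank Mᵥ x
    toℕ-rankClass {x} Mᵥx with rank Mᵥ x <? d
    ... | yes r<d = Fin.toℕ-fromℕ< r<d
    ... | no  r≮d = ⊥-elim (r≮d (<-≤-trans (rank<count Mᵥ Mᵥx) count-Mᵥ≤d))

  record Assignment : Set where
    field
      placed : EdgeSet m
      class  : Fin m → Fin d
  open Assignment

  load : Assignment → Fin d → ℕ
  load s i = ∑[ e < m ] when ((placed s e ∧ ⌊ class s e ≟ i ⌋) ∧ H e) (wt e)

  Occupied : Assignment → ℕ → Pred (Fin d) 0ℓ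
  Occupied s k i = ∃ λ e → T (placed s e) × class s e ≡ i × nb# e ≡ k

  occupied? : ∀ s k → Decidable (Occupied s k)
  occupied? s k i = Fin.any? (λ e → T? (placed s e) ×-dec class s e ≟ i ×-dec nb# e ≟ℕ k)

  place : Assignment → Fin m → Fin d → Assignment
  place s e a = record
    { placed = λ e' → ⌊ e ≟ e' ⌋ ∨ placed s e'
    ; class  = λ e' → if ⌊ e ≟ e' ⌋ then a else class s e'
    }

  module _ (s : Assignment) (e : Fin m) (a : Fin d) where

    placed-place-self : T (placed (place s e a) e)
    placed-place-self with e ≟ e
    ... | yes _   = tt
    ... | no  e≢e = ⊥-elim (e≢e refl)

    class-place-self : class (place s e a) e ≡ a
    class-place-self with e ≟ e
    ... | yes _   = refl
    ... | no  e≢e = ⊥-elim (e≢e refl)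

    class-place-other : ∀ {e'} → e ≢ e' → class (place s e a) e' ≡ class s e'
    class-place-other {e'} e≢e' with e ≟ e'
    ... | yes e≡e' = ⊥-elim (e≢e' e≡e')
    ... | no  _    = refl

    placed-place-mono : ∀ {e'} → T (placed s e') → T (placed (place s e a) e')
    placed-place-mono {e'} p with e ≟ e'
    ... | yes _ = tt
    ... | no  _ = p

    load-place : ¬ T (placed s e) → T (H e) → ∀ i → load (place s e a) i ≡ load s i + when ⌊ a ≟ i ⌋ (wt e)
    load-place unplaced He i = begin
      load (place s e a) i                                     ≡⟨ sum-cong-≗ pointwise ⟩
      ∑[ e' < m ] (term e' + when ⌊ e ≟ e' ⌋ (when ⌊ a ≟ i ⌋ (wt e)))  ≡⟨ ∑-distrib-+ term _ ⟩
      load s i + ∑[ e' < m ] when ⌊ e ≟ e' ⌋ (when ⌊ a ≟ i ⌋ (wt e))   ≡⟨ cong (_+_ (load s i)) (∑-indicator e _) ⟩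
      load s i + when ⌊ a ≟ i ⌋ (wt e)                         ∎
      where
      open ≡-Reasoning
      term : Fin m → ℕ
      term e' = when ((placed s e' ∧ ⌊ class s e' ≟ i ⌋) ∧ H e') (wt e')
      pointwise : ∀ e' → when ((placed (place s e a) e' ∧ ⌊ class (place s e a) e' ≟ i ⌋) ∧ H e') (wt e')
                         ≡ term e' + when ⌊ e ≟ e' ⌋ (when ⌊ a ≟ i ⌋ (wt e))
      pointwise e' with e ≟ e'
      ... | no  _    = sym (+-identityʳ _)
      ... | yes refl with placed s e | H e | a ≟ i
      ...   | false | true  | yes _ = refl
      ...   | false | true  | no  _ = refl
      ...   | true  | _     | _     = ⊥-elim (unplaced tt)
      ...   | false | false | _     = ⊥-elim He

    Occupied-place⁻ : ∀ {k i} → Occupied (place s e a) k i → a ≡ i ⊎ Occupied s k i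
    Occupied-place⁻ {k} {i} (e' , placed' , class'≡i , nb≡k) with e ≟ e'
    ... | yes refl = inj₁ class'≡i
    ... | no  _    = inj₂ (e' , placed' , class'≡i , nb≡k)

    Occupied-place⁺ : ∀ {k i} → ¬ T (placed s e) → Occupied s k i → Occupied (place s e a) k i
    Occupied-place⁺ unplaced (e' , placed-e' , class≡i , nb≡k) =
      e' , placed-place-mono placed-e' , trans (class-place-other e≢e') class≡i , nb≡k
      where
      e≢e' : e ≢ e'
      e≢e' refl = unplaced placed-e'

    Occupied-place-new : ∀ {k} → nb# e ≡ k → Occupied (place s e a) k a
    Occupied-place-new nb≡k = e , placed-place-self , class-place-self , nb≡k

  some-class-unoccupied : ∀ {s k e} → (∀ e' → T (placed s e') → T (inc e')) →
                          T (inc e) → ¬ T (placed s e) → nb# e ≡ k → ¬ (∀ i → Occupied s k i)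
  some-class-unoccupied {s} {k} {e} placed⇒inc inc-e unplaced nb≡k all-occupied = <-irrefl refl (begin-strict
    d                                      ≤⟨ count-covering (class s) covered ⟩
    count X                                <⟨ count-< X⊆parallel e (unplaced ∘ proj₁ ∘ ∧-elim (placed s e)) parallel-e ⟩
    count (λ e' → between G e' (nb e) v)  ≡⟨ sumOver≡∑ G (λ e' → between G e' (nb e) v) (λ _ → 1) ⟨
    card G (λ e' → between G e' (nb e) v) ≤⟨ multiplicity (nb e) (neighbour≢ G (noLoop e) inc-e) ⟩
    b (nb e) ⊓ d                           ≤⟨ m⊓n≤n (b (nb e)) d ⟩
    d                                      ∎)
    where
    open ≤-Reasoning
    X : EdgeSet m
    X e' = placed s e' ∧ ⌊ nb# e' ≟ℕ k ⌋
    covered : ∀ i → ∃ λ e' → T (X e') × class s e' ≡ i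
    covered i with all-occupied i
    ... | e' , placed-e' , class≡i , nb≡k' = e' , from T-∧ (placed-e' , fromWitness nb≡k') , class≡i
    parallel-e : T (between G e (nb e) v)
    parallel-e = between-neighbour G inc-e
    X⊆parallel : ∀ e' → T (X e') → T (between G e' (nb e) v)
    X⊆parallel e' Xe' with ∧-elim (placed s e') Xe'
    ... | placed-e' , nb≡k' = subst (λ u → T (between G e' u v))
                                    (Fin.toℕ-injective (trans (toWitness nb≡k') (sym nb≡k)))
                                    (between-neighbour G (placed⇒inc e' placed-e'))

  record Layout (lo hi : ℕ) (s : Assignment) : Set where
    field
      placed⇒       : ∀ e → T (placed s e) → T (Mᵥ e) ⊎ (T (Hᵥ e) × nb# e < hi)
      matchedPlaced : ∀ e → T (Mᵥ e) → T (placed s e) × class s e ≡ rankClass e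
      donePlaced    : ∀ e → T (Hᵥ e) → nb# e < lo → T (placed s e)
      separated     : ∀ e e' → T (placed s e) → T (placed s e') →
                      class s e ≡ class s e' → nb e ≡ nb e' → e ≡ e'

    placed⇒inc : ∀ e → T (placed s e) → T (inc e)
    placed⇒inc e p with placed⇒ e p
    ... | inj₁ Mᵥe       = Sᵥ⇒inc (Mᵥ⇒Sᵥ Mᵥe)
    ... | inj₂ (Hᵥe , _) = Sᵥ⇒inc (Hᵥ⇒Sᵥ Hᵥe)

  Layout-place : ∀ {lo k s e a} → Layout lo (suc k) s → T (Hᵥ e) → nb# e ≡ k → ¬ T (placed s e) →
                 ¬ Occupied s k a → Layout lo (suc k) (place s e a)
  Layout-place {lo} {k} {s} {e} {a} L Hᵥe nb≡k unplaced unoccupied = record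
    { placed⇒       = placed⇒'
    ; matchedPlaced = matchedPlaced'
    ; donePlaced    = λ e' Hᵥe' lt → placed-place-mono s e a (donePlaced e' Hᵥe' lt)
    ; separated     = separated'
    }
    where
    open Layout L
    s' = place s e a

    e≢placed : ∀ {e'} → T (placed s e') → e ≢ e'
    e≢placed p refl = unplaced p

    placed⇒' : ∀ e' → T (placed s' e') → T (Mᵥ e') ⊎ (T (Hᵥ e') × nb# e' < suc k)
    placed⇒' e' p' with e ≟ e'
    ... | yes refl = inj₂ (Hᵥe , ≤-reflexive (cong suc nb≡k))
    ... | no  _    = placed⇒ e' p'

    matchedPlaced' : ∀ e' → T (Mᵥ e') → T (placed s' e') × class s' e' ≡ rankClass e'
    matchedPlaced' e' Mᵥe' with matchedPlaced e' Mᵥe'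
    ... | p , class≡rank = placed-place-mono s e a p , trans (class-place-other s e a (e≢placed p)) class≡rank

    clash : ∀ {e'} → T (placed s e') → class s e' ≡ a → nb e ≡ nb e' → ⊥
    clash {e'} p class≡a nb≡nb' = unoccupied (e' , p , class≡a , trans (cong toℕ (sym nb≡nb')) nb≡k)

    separated' : ∀ e₁ e₂ → T (placed s' e₁) → T (placed s' e₂) → class s' e₁ ≡ class s' e₂ → nb e₁ ≡ nb e₂ → e₁ ≡ e₂
    separated' e₁ e₂ p₁ p₂ c≡ nb≡ with e ≟ e₁ | e ≟ e₂
    ... | yes refl | yes refl = refl
    ... | yes refl | no  _    = ⊥-elim (clash p₂ (sym c≡) nb≡)
    ... | no  _    | yes refl = ⊥-elim (clash p₁ c≡ (sym nb≡))
    ... | no  _    | no  _    = separated e₁ e₂ p₁ p₂ c≡ nb≡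

  Pending : ℕ → Fin d → Set
  Pending k i = ∀ e → T (Mᵥ e) → rankClass e ≡ i → k ≤ nb# e

  record Stage (k : ℕ) (s : Assignment) : Set where
    field
      layout    : Layout k k s
      nearMax2W : ∀ i → NearMax (W + W) (load s) i
      nearMaxW  : ∀ i → Pending k i → NearMax W (load s) i

  record InRound (k : ℕ) (c : Fin d → ℕ) (ω : ℕ) (s : Assignment) : Set where
    field
      layout  : Layout k (suc k) s
      balance : Round c ω (Occupied s k) (load s)
      gained  : ∀ e → T (placed s e) → T (Hᵥ e) → nb# e ≡ k → c (class s e) < load s (class s e)

  InRound-place : ∀ {k c w s e a} → InRound k c w s → T (Hᵥ e) → nb# e ≡ k → wt e ≡ w →
                  ¬ T (placed s e) → ¬ Occupied s k a → (∀ j → ¬ Occupied s k j → load s a ≤ load s j) →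
                  InRound k c w (place s e a)
  InRound-place {k} {c} {w} {s} {e} {a} I Hᵥe nb≡k refl unplaced unoccupied minimal = record
    { layout  = Layout-place layout Hᵥe nb≡k unplaced unoccupied
    ; balance = round-step balance a unoccupied minimal (1≤wt e) (wt≤W e) ≤-refl
                  load≡ (Occupied-place⁻ s e a) (Occupied-place-new s e a nb≡k) (Occupied-place⁺ s e a unplaced)
    ; gained  = gained'
    }
    where
    open InRound I
    s' = place s e a

    load≡ : ∀ i → load s' i ≡ load s i + when ⌊ a ≟ i ⌋ (wt e)
    load≡ = load-place s e a unplaced (Hᵥ⇒H Hᵥe)

    load≤ : ∀ i → load s i ≤ load s' i
    load≤ i = subst (load s i ≤_) (sym (load≡ i)) (m≤m+n (load s i) _)

    gained' : ∀ e' → T (placed s' e') → T (Hᵥ e') → nb# e' ≡ k → c (class s' e') < load s' (class s' e')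
    gained' e' p' Hᵥe' nb≡k' with e ≟ e'
    ... | yes refl = begin-strict
      c a                ≤⟨ Round.grows balance a ⟩
      load s a           <⟨ m<m+n (load s a) (1≤wt e) ⟩
      load s a + wt e    ≡⟨ cong (_+_ (load s a)) (when-true (wt e) (fromWitness refl)) ⟨
      load s a + when ⌊ a ≟ a ⌋ (wt e) ≡⟨ load≡ a ⟨
      load s' a          ∎
      where open ≤-Reasoning
    ... | no  _    = <-≤-trans (gained e' p' Hᵥe' nb≡k') (load≤ (class s e'))

  InRound-weaken : ∀ {k c ω ω' s} → ω' ≤ ω → InRound k c ω s → InRound k c ω' s
  InRound-weaken ω'≤ω I = record
    { layout = InRound.layout I ; balance = round-weaken ω'≤ω (InRound.balance I) ; gained = InRound.gained I }

  Eligible : ℕ → ℕ → Assignment → Pred (Fin m) 0ℓ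
  Eligible k w s e = T (Hᵥ e) × nb# e ≡ k × wt e ≡ w × ¬ T (placed s e)

  eligible? : ∀ k w s → Decidable (Eligible k w s)
  eligible? k w s e = T? (Hᵥ e) ×-dec nb# e ≟ℕ k ×-dec wt e ≟ℕ w ×-dec ¬? (T? (placed s e))

  step : ℕ → ℕ → Assignment → Fin m → Assignment
  step k w s e with eligible? k w s e
  ... | no  _ = s
  ... | yes _ with argmin (¬? ∘ occupied? s k) (load s)
  ...   | inj₁ _           = s
  ...   | inj₂ (a , _ , _) = place s e a

  step-mono : ∀ {k w s e e'} → T (placed s e') → T (placed (step k w s e) e')
  step-mono {k} {w} {s} {e} p with eligible? k w s e
  ... | no  _ = p
  ... | yes _ with argmin (¬? ∘ occupied? s k) (load s)
  ...   | inj₁ _           = p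
  ...   | inj₂ (a , _ , _) = placed-place-mono s e a p

  module _ {k : ℕ} {c : Fin d → ℕ} {w : ℕ} where

    some-class-free : ∀ {s e} → InRound k c w s → Eligible k w s e → ¬ (∀ i → ¬ ¬ Occupied s k i)
    some-class-free {s} I (Hᵥe , nb≡k , _ , unplaced) none =
      some-class-unoccupied (Layout.placed⇒inc (InRound.layout I)) (Sᵥ⇒inc (Hᵥ⇒Sᵥ Hᵥe)) unplaced nb≡k
        (λ i → decidable-stable (occupied? s k i) (none i))

    step-preserves : ∀ {s} e → InRound k c w s → InRound k c w (step k w s e)
    step-preserves {s} e I with eligible? k w s e
    ... | no  _ = I
    ... | yes eligible@(Hᵥe , nb≡k , wt≡w , unplaced) with argmin (¬? ∘ occupied? s k) (load s)
    ...   | inj₁ none = ⊥-elim (some-class-free I eligible none)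
    ...   | inj₂ (a , unoccupied , minimal) = InRound-place I Hᵥe nb≡k wt≡w unplaced unoccupied minimal

    step-places : ∀ {s e} → InRound k c w s → T (Hᵥ e) → nb# e ≡ k → wt e ≡ w → T (placed (step k w s e) e)
    step-places {s} {e} I Hᵥe nb≡k wt≡w with eligible? k w s e
    ... | no  ineligible =
      decidable-stable (T? (placed s e)) (λ unplaced → ineligible (Hᵥe , nb≡k , wt≡w , unplaced))
    ... | yes eligible with argmin (¬? ∘ occupied? s k) (load s)
    ...   | inj₁ none        = ⊥-elim (some-class-free I eligible none)
    ...   | inj₂ (a , _ , _) = placed-place-self s e a

  sweep : ℕ → ℕ → Assignment → Assignment
  sweep k w s = foldl (step k w) s (allFin m)

  runRound : ℕ → ℕ → Assignment → Assignment
  runRound k zero    s = s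
  runRound k (suc w) s = runRound k w (sweep k (suc w) s)

  initial : Assignment
  initial = record { placed = Mᵥ ; class = rankClass }

  stage : ℕ → Assignment
  stage zero    = initial
  stage (suc k) = runRound k W (stage k)

  module _ {k : ℕ} {c : Fin d → ℕ} where

    sweep-preserves : ∀ {w s} → InRound k c w s → InRound k c w (sweep k w s)
    sweep-preserves {w} = foldl-preserves (step k w) (InRound k c w) (λ e → step-preserves {w = w} e) (allFin m)

    sweep-mono : ∀ {w s e} → T (placed s e) → T (placed (sweep k w s) e)
    sweep-mono {w} {e = e} = foldl-preserves (step k w) (λ s → T (placed s e)) (λ _ → step-mono) (allFin m)

    sweep-places : ∀ {w s e} → InRound k c w s → T (Hᵥ e) → nb# e ≡ k → wt e ≡ w → T (placed (sweep k w s) e)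
    sweep-places {w} {e = e} I Hᵥe nb≡k wt≡w =
      foldl-establishes (step k w) (InRound k c w) (λ s → T (placed s e)) (λ e' → step-preserves {w = w} e') (λ _ → step-mono)
        (λ I' → step-places I' Hᵥe nb≡k wt≡w) (∈-allFin e) I

    runRound-preserves : ∀ w {s} → InRound k c w s → InRound k c 0 (runRound k w s)
    runRound-preserves zero    I = I
    runRound-preserves (suc w) I = runRound-preserves w (InRound-weaken (n≤1+n w) (sweep-preserves I))

    runRound-mono : ∀ w {s e} → T (placed s e) → T (placed (runRound k w s) e)
    runRound-mono zero    p = p
    runRound-mono (suc w) p = runRound-mono w (sweep-mono p)

    runRound-places : ∀ w {s e} → InRound k c w s → T (Hᵥ e) → nb# e ≡ k → wt e ≤ w →
                      T (placed (runRound k w s) e)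
    runRound-places zero    {e = e} I Hᵥe nb≡k wt≤0 = ⊥-elim (<-irrefl refl (≤-trans (1≤wt e) wt≤0))
    runRound-places (suc w) {e = e} I Hᵥe nb≡k wt≤ with m≤n⇒m<n∨m≡n wt≤
    ... | inj₂ wt≡     = runRound-mono w (sweep-places I Hᵥe nb≡k wt≡)
    ... | inj₁ wt<1+w  =
      runRound-places w (InRound-weaken (n≤1+n w) (sweep-preserves I)) Hᵥe nb≡k (≤-pred wt<1+w)

  occupant-matched : ∀ {k s i} → Layout k k s → Occupied s k i → ∃ λ e → T (Mᵥ e) × rankClass e ≡ i × nb# e ≡ k
  occupant-matched L (e , p , class≡i , nb≡k) with Layout.placed⇒ L e p
  ... | inj₁ Mᵥe          = e , Mᵥe , trans (sym (proj₂ (Layout.matchedPlaced L e Mᵥe))) class≡i , nb≡k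
  ... | inj₂ (_ , nb<k)   = ⊥-elim (<-irrefl nb≡k nb<k)

  start-round : ∀ {k s} → Stage k s → InRound k (load s) W s
  start-round {k} {s} S = record
    { layout  = record
      { placed⇒       = λ e p → Sum.map₂ (Product.map₂ m<n⇒m<1+n) (placed⇒ e p)
      ; matchedPlaced = matchedPlaced
      ; donePlaced    = donePlaced
      ; separated     = separated
      }
    ; balance = round-start blocked-nearMax
    ; gained  = nothing-gained
    }
    where
    open Stage S
    open Layout layout

    -- a class blocked in round k holds the matching edge to the k-th neighbour, so it was pending
    blocked-nearMax : ∀ i → Occupied s k i → NearMax W (load s) i
    blocked-nearMax i occupied with occupant-matched layout occupied
    ... | e , Mᵥe , rank≡i , nb≡k = nearMaxW i pending
      where
      pending : Pending k i
      pending e' Mᵥe' rank'≡i rewrite rankClass-injective Mᵥe' Mᵥe (trans rank'≡i (sym rank≡i)) = ≤-reflexive (sym nb≡k)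

    nothing-gained : ∀ e → T (placed s e) → T (Hᵥ e) → nb# e ≡ k → load s (class s e) < load s (class s e)
    nothing-gained e p Hᵥe nb≡k with placed⇒ e p
    ... | inj₁ Mᵥe        = ⊥-elim (Mᵥ⇒¬Hᵥ Mᵥe Hᵥe)
    ... | inj₂ (_ , nb<k) = ⊥-elim (<-irrefl nb≡k nb<k)

  finish-round : ∀ {k s s' ω} → Stage k s → InRound k (load s) ω s' →
                 (∀ e → T (Hᵥ e) → nb# e ≡ k → T (placed s' e)) → Stage (suc k) s'
  finish-round {k} {s} {s'} S I round-done = record
    { layout    = record
      { placed⇒       = placed⇒
      ; matchedPlaced = matchedPlaced
      ; donePlaced    = donePlaced'
      ; separated     = separated
      }
    ; nearMax2W = λ i → round-nearMax balance (occupied? s' k) (m≤m+n W W) (Stage.nearMax2W S i) (λ _ _ → ≤-refl)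
    ; nearMaxW  = λ i pending → round-nearMax balance (occupied? s' k) ≤-refl
                    (Stage.nearMaxW S i (λ e Mᵥe r≡i → ≤-trans (n≤1+n k) (pending e Mᵥe r≡i)))
                    (λ occupied unchanged → ⊥-elim (not-blocked i pending occupied unchanged))
    }
    where
    open InRound I
    open Layout layout

    donePlaced' : ∀ e → T (Hᵥ e) → nb# e < suc k → T (placed s' e)
    donePlaced' e Hᵥe nb<1+k with m≤n⇒m<n∨m≡n (≤-pred nb<1+k)
    ... | inj₁ nb<k = donePlaced e Hᵥe nb<k
    ... | inj₂ nb≡k = round-done e Hᵥe nb≡k

    not-blocked : ∀ i → Pending (suc k) i → Occupied s' k i → load s' i ≡ load s i → ⊥
    not-blocked i pending (e , p , class≡i , nb≡k) unchanged with placed⇒ e p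
    ... | inj₁ Mᵥe = <-irrefl (sym nb≡k)
                       (pending e Mᵥe (trans (sym (proj₂ (matchedPlaced e Mᵥe))) class≡i))
    ... | inj₂ (Hᵥe , _) = <-irrefl (sym unchanged) (subst (λ j → load s j < load s' j) class≡i (gained e p Hᵥe nb≡k))

  initial-stage : Stage 0 initial
  initial-stage = record
    { layout    = record
      { placed⇒       = λ e Mᵥe → inj₁ Mᵥe
      ; matchedPlaced = λ e Mᵥe → Mᵥe , refl
      ; donePlaced    = λ e _ ()
      ; separated     = λ e e' Mᵥe Mᵥe' r≡r' _ → rankClass-injective Mᵥe Mᵥe' r≡r'
      }
    ; nearMax2W = λ i j → ≤-trans (load≤W j) (≤-trans (m≤m+n W W) (m≤n+m (W + W) (load initial i)))
    ; nearMaxW  = λ i _ j → ≤-trans (load≤W j) (m≤n+m W (load initial i))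
    }
    where
    counted : ∀ {e j} → T ((Mᵥ e ∧ ⌊ rankClass e ≟ j ⌋) ∧ H e) → T (Mᵥ e) × rankClass e ≡ j
    counted {e} {j} t with ∧-elim (Mᵥ e ∧ ⌊ rankClass e ≟ j ⌋) t
    ... | x , _ with ∧-elim (Mᵥ e) x
    ...   | Mᵥe , r≡j = Mᵥe , toWitness r≡j

    load≤W : ∀ j → load initial j ≤ W
    load≤W j = ∑≤-unique-support W
      (λ e e' p q → let Mᵥe , r≡j = counted (when-pos p) ; Mᵥe' , r'≡j = counted (when-pos q)
                    in rankClass-injective Mᵥe Mᵥe' (trans r≡j (sym r'≡j)))
      (λ e → ≤-trans (when-≤ _ (wt e)) (wt≤W e))

  stage-invariant : ∀ k → Stage k (stage k)
  stage-invariant zero    = initial-stage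
  stage-invariant (suc k) = finish-round S (runRound-preserves W (start-round S))
    (λ e Hᵥe nb≡k → runRound-places W (start-round S) Hᵥe nb≡k (wt≤W e))
    where S = stage-invariant k

  final : Assignment
  final = stage n

  part : Fin m → Fin d
  part = class final

  E : Fin d → EdgeSet m
  E i e = Sᵥ e ∧ ⌊ part e ≟ i ⌋

  private
    held-at-v : ∀ h m i → ((h ∨ m) ∧ i) ∧ h ≡ h ∧ i
    held-at-v true  m     i = ∧-identityʳ i
    held-at-v false true  i = ∧-zeroʳ i
    held-at-v false false i = refl

  open Stage (stage-invariant n)
  open Layout layout

  placed-final : ∀ e → placed final e ≡ Sᵥ e
  placed-final e = T-extensional placed⇒Sᵥ Sᵥ⇒placed
    where
    placed⇒Sᵥ : T (placed final e) → T (Sᵥ e)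
    placed⇒Sᵥ p with placed⇒ e p
    ... | inj₁ Mᵥe       = Mᵥ⇒Sᵥ Mᵥe
    ... | inj₂ (Hᵥe , _) = Hᵥ⇒Sᵥ Hᵥe
    Sᵥ⇒placed : T (Sᵥ e) → T (placed final e)
    Sᵥ⇒placed Sᵥe with Sᵥ⇒Mᵥ⊎Hᵥ Sᵥe
    ... | inj₁ Mᵥe = proj₁ (matchedPlaced e Mᵥe)
    ... | inj₂ Hᵥe = donePlaced e Hᵥe (Fin.toℕ<n (nb e))

  E⁻ : ∀ {i e} → T (E i e) → T (Sᵥ e) × part e ≡ i
  E⁻ {i} {e} t = let Sᵥe , part≡i = ∧-elim (Sᵥ e) t in Sᵥe , toWitness part≡i

  matched∈E : ∀ {i e} → T (E i e) → T (M e) → T (Mᵥ e)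
  matched∈E {i} {e} t Me = from T-∧ (Me , Sᵥ⇒inc (proj₁ (E⁻ t)))

  weightOutsideH∈E : ∀ {i e} → T (E i e) → ¬ T (H e) → T (Mᵥ e)
  weightOutsideH∈E t ¬He with Sᵥ⇒Mᵥ⊎Hᵥ (proj₁ (E⁻ t))
  ... | inj₁ Mᵥe = Mᵥe
  ... | inj₂ Hᵥe = ⊥-elim (¬He (Hᵥ⇒H Hᵥe))

  matched-in-E-unique : ∀ i {e e'} → T (Mᵥ e) → part e ≡ i → T (Mᵥ e') → part e' ≡ i → e ≡ e'
  matched-in-E-unique i {e} {e'} Mᵥe part≡i Mᵥe' part'≡i = rankClass-injective Mᵥe Mᵥe'
    (trans (sym (proj₂ (matchedPlaced e Mᵥe))) (trans (trans part≡i (sym part'≡i)) (proj₂ (matchedPlaced e' Mᵥe'))))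

  one-matching-edge : ∀ i → card G (λ e → E i e ∧ M e) ≤ 1
  one-matching-edge i = subst (_≤ 1) (sym (sumOver≡∑ G _ (λ _ → 1))) (count≤1 unique)
    where
    unique : ∀ e e' → T (E i e ∧ M e) → T (E i e' ∧ M e') → e ≡ e'
    unique e e' t t' with ∧-elim (E i e) t | ∧-elim (E i e') t'
    ... | mem , Me | mem' , Me' = matched-in-E-unique i
      (matched∈E mem Me) (proj₂ (E⁻ mem)) (matched∈E mem' Me') (proj₂ (E⁻ mem'))

  one-edge-per-neighbour : ∀ i u → u ≢ v → card G (λ e → E i e ∧ between G e u v) ≤ 1
  one-edge-per-neighbour i u u≢v = subst (_≤ 1) (sym (sumOver≡∑ G _ (λ _ → 1))) (count≤1 unique)
    where
    unpack : ∀ {e} → T (E i e ∧ between G e u v) → T (placed final e) × part e ≡ i × nb e ≡ u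
    unpack {e} t with ∧-elim (E i e) t
    ... | mem , uv with E⁻ mem
    ...   | Sᵥe , part≡i = subst T (sym (placed-final e)) Sᵥe , part≡i , neighbour-between G uv u≢v
    unique : ∀ e e' → T (E i e ∧ between G e u v) → T (E i e' ∧ between G e' u v) → e ≡ e'
    unique e e' t t' with unpack t | unpack t'
    ... | p , part≡i , nb≡u | p' , part'≡i , nb'≡u =
      separated e e' p p' (trans part≡i (sym part'≡i)) (trans nb≡u (sym nb'≡u))

  weightOutsideH : Fin d → ℕ
  weightOutsideH i = ∑[ e < m ] when (E i e ∧ not (H e)) (wt e)

  weightOutsideH≤W : ∀ i → weightOutsideH i ≤ W
  weightOutsideH≤W i = ∑≤-unique-support W unique (λ e → ≤-trans (when-≤ _ (wt e)) (wt≤W e))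
    where
    unique : ∀ e e' → 0 < when (E i e ∧ not (H e)) (wt e) → 0 < when (E i e' ∧ not (H e')) (wt e') → e ≡ e'
    unique e e' p q with ∧-elim (E i e) (when-pos p) | ∧-elim (E i e') (when-pos q)
    ... | mem , ¬He | mem' , ¬He' = matched-in-E-unique i
      (weightOutsideH∈E mem (not⇒¬ (H e) ¬He)) (proj₂ (E⁻ mem)) (weightOutsideH∈E mem' (not⇒¬ (H e') ¬He')) (proj₂ (E⁻ mem'))

  weight-E : ∀ i → weight G (E i) ≡ load final i + weightOutsideH i
  weight-E i = begin
    weight G (E i)                       ≡⟨ sumOver≡∑ G (E i) wt ⟩
    ∑[ e < m ] when (E i e) (wt e)       ≡⟨ sum-cong-≗ split ⟩
    ∑[ e < m ] (held e + when (E i e ∧ not (H e)) (wt e))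
                                              ≡⟨ ∑-distrib-+ held _ ⟩
    load final i + weightOutsideH i                   ∎
    where
    open ≡-Reasoning
    held : Fin m → ℕ
    held e = when ((placed final e ∧ ⌊ part e ≟ i ⌋) ∧ H e) (wt e)
    split : ∀ e → when (E i e) (wt e) ≡ held e + when (E i e ∧ not (H e)) (wt e)
    split e = trans (when-split (E i e) (H e) (wt e))
                    (cong (λ x → when ((x ∧ ⌊ part e ≟ i ⌋) ∧ H e) (wt e) + when (E i e ∧ not (H e)) (wt e))
                          (sym (placed-final e)))

  ∑-load-final : ∑[ i < d ] load final i ≡ wdeg G H v
  ∑-load-final = begin
    ∑[ i < d ] ∑[ e < m ] when ((placed final e ∧ ⌊ part e ≟ i ⌋) ∧ H e) (wt e)
      ≡⟨ ∑-comm (λ i e → when ((placed final e ∧ ⌊ part e ≟ i ⌋) ∧ H e) (wt e)) ⟩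
    ∑[ e < m ] ∑[ i < d ] when ((placed final e ∧ ⌊ part e ≟ i ⌋) ∧ H e) (wt e)
      ≡⟨ sum-cong-≗ (λ e → trans (sum-cong-≗ {d} (λ i → when-∧-∧ (placed final e) ⌊ part e ≟ i ⌋ (H e) (wt e)))
                                   (∑-indicator (part e) (when (placed final e ∧ H e) (wt e)))) ⟩
    ∑[ e < m ] when (placed final e ∧ H e) (wt e)
      ≡⟨ sum-cong-≗ (λ e → cong (λ x → when (x ∧ H e) (wt e)) (placed-final e)) ⟩
    ∑[ e < m ] when (Sᵥ e ∧ H e) (wt e)
      ≡⟨ sum-cong-≗ (λ e → cong (λ x → when x (wt e)) (held-at-v (H e) (M e) (inc e))) ⟩
    ∑[ e < m ] when (H e ∧ inc e) (wt e)
      ≡⟨ sumOver≡∑ G (δ G H v) wt ⟨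
    wdeg G H v
      ∎
    where open ≡-Reasoning

  load≤weight : ∀ i → load final i ≤ weight G (E i)
  load≤weight i = subst (load final i ≤_) (sym (weight-E i)) (m≤m+n (load final i) (weightOutsideH i))

  weight-lower : ∀ i → wdeg G H v ≤ d * (weight G (E i) + 2 * W)
  weight-lower i = begin
    wdeg G H v                          ≡⟨ ∑-load-final ⟨
    ∑[ j < d ] load final j             ≤⟨ ∑≤* (nearMax2W i) ⟩
    d * (load final i + (W + W))        ≤⟨ *-monoʳ-≤ d (+-monoˡ-≤ (W + W) (load≤weight i)) ⟩
    d * (weight G (E i) + (W + W)) ≡⟨ cong (λ x → d * (weight G (E i) + x)) (cong (_+_ W) (+-identityʳ W)) ⟨
    d * (weight G (E i) + 2 * W)   ∎
    where open ≤-Reasoning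

  weight-upper : ∀ i → d * weight G (E i) ≤ wdeg G H v + 3 * W * d
  weight-upper i = begin
    d * weight G (E i)                     ≡⟨ cong (d *_) (weight-E i) ⟩
    d * (load final i + weightOutsideH i)               ≤⟨ *-monoʳ-≤ d (+-monoʳ-≤ (load final i) (weightOutsideH≤W i)) ⟩
    d * (load final i + W)                      ≡⟨ *-distribˡ-+ d (load final i) W ⟩
    d * load final i + d * W                    ≤⟨ +-monoˡ-≤ (d * W) (*≤∑ (λ j → nearMax2W j i)) ⟩
    ∑[ j < d ] (load final j + (W + W)) + d * W ≡⟨ cong (_+ d * W) ∑-shifted ⟩
    wdeg G H v + d * (W + W) + d * W            ≡⟨ solve 3 (λ D w x → x :+ D :* (w :+ w) :+ D :* w := x :+ con 3 :* w :* D)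
                                                         refl d W (wdeg G H v) ⟩
    wdeg G H v + 3 * W * d                      ∎
    where
    open ≤-Reasoning
    ∑-shifted : ∑[ j < d ] (load final j + (W + W)) ≡ wdeg G H v + d * (W + W)
    ∑-shifted = trans (∑-distrib-+ (load final) (λ _ → W + W)) (cong₂ _+_ ∑-load-final (∑-const d (W + W)))

lemma31 : ∀ {n m : ℕ} (G : WGraph n m) (W : ℕ) (b : Fin n → ℕ) (β β⁻ : ℤ)
    → IsValid G W b
    → + 3 ℤ.≤ β → β⁻ ℤ.≤ β ℤ.- + 2
    → (H : EdgeSet m) → IsEDCS G b β β⁻ H
    → (M : EdgeSet m) → IsMaxWeightBMatching G b M
    → (v : Fin n)
    → Σ (Fin m → Fin (b v)) λ part →
        ∀ (i : Fin (b v)) →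
          let Eᵢ : EdgeSet m
              Eᵢ e = δ G (λ e' → H e' ∨ M e') v e ∧ ⌊ part e ≟ i ⌋
          in card G (λ e → Eᵢ e ∧ M e) ≤ 1
           × (∀ (u : Fin n) → ¬ (u ≡ v) → card G (λ e → Eᵢ e ∧ between G e u v) ≤ 1)
           × (wdeg G H v ≤ b v * (weight G Eᵢ + 2 * W))
           × (b v * weight G Eᵢ ≤ wdeg G H v + 3 * W * b v)
lemma31 G W b β β⁻ (noLoop , 1≤wt , wt≤W , 1≤b , multiplicity) _ _ H _ M (bMatching , _) v =
  part , λ i → one-matching-edge i , one-edge-per-neighbour i , weight-lower i , weight-upper i
  where
  open AtVertex G W b H M v noLoop 1≤wt wt≤W (1≤b v) (λ u → multiplicity u v) (bMatching v)
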